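{- Let $G$ be a graph with diameter $2$. Then $strc(G)\le src(G)+1$.
   Context: All graphs are finite and simple. An edge-coloured path is rainbow if its edges have distinct colours. The strong rainbow connection number $src(G)$ of a connected graph $G$ is the minimum number of colours in an edge-colouring such that any two vertices $u,v$ are joined by a rainbow $u$–$v$ geodesic (a $u$–$v$ path of length $d(u,v)$). A total-coloured path is total-rainbow if its edges and internal vertices have pairwise distinct colours; the strong total rainbow connection number $strc(G)$ is the minimum number of colours in a total-colouring (of vertices and edges) such that any two vertices $u,v$ are joined by a total-rainbow $u$–$v$ geodesic. -}

module Defs where

open import Data.Nat using (ℕ; zero; suc; _<_; _≤_)
open import Data.Fin using (Fin)
open import Data.Bool using (Bool; true)
open import Data.List using (List; []; _∷_; _++_; map)
open import Data.List.Relation.Unary.Unique.Propositional using (Unique)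
open import Data.Product using (Σ; ∃; ∃-syntax; _×_; _,_)
open import Relation.Binary.PropositionalEquality using (_≡_)
open import Relation.Nullary using (¬_)

record Graph (n : ℕ) : Set where
  field
    adj     : Fin n → Fin n → Bool
    adj-sym : ∀ u v → adj u v ≡ adj v u
    irrefl  : ∀ u → ¬ (adj u u ≡ true)
open Graph public

module _ {n : ℕ} (G : Graph n) where

  data Walk : Fin n → Fin n → ℕ → Set where
    []  : ∀ {u} → Walk u u 0
    _∷_ : ∀ {u w v L} → adj G u w ≡ true → Walk w v L → Walk u v (suc L)

  Dist : Fin n → Fin n → ℕ → Set
  Dist u v d = Walk u v d × (∀ m → m < d → ¬ Walk u v m)

  HasDiameter : ℕ → Set
  HasDiameter D = (∀ u v → ∃[ d ] (d ≤ D × Dist u v d))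
                × (∃[ u ] ∃[ v ] Dist u v D)

  edgeColours : ∀ {k} → (Fin n → Fin n → Fin k) → ∀ {u v L} → Walk u v L → List (Fin k)
  edgeColours c [] = []
  edgeColours c (_∷_ {u} {w} e p) = c u w ∷ edgeColours c p

  innerVertices : ∀ {u v L} → Walk u v L → List (Fin n)
  innerVertices [] = []
  innerVertices (e ∷ []) = []
  innerVertices (_∷_ {u} {w} e (e' ∷ p)) = w ∷ innerVertices (e' ∷ p)

  -- Edge-colourings with k colours (edge colour c u v = c v u; only
  -- values on edges matter).
  record EdgeColouring (k : ℕ) : Set where
    field
      ecol : Fin n → Fin n → Fin k
      ecol-sym : ∀ u v → ecol u v ≡ ecol v u
  open EdgeColouring public

  record TotalColouring (k : ℕ) : Set where
    field
      vcol : Fin n → Fin k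
      tcol : Fin n → Fin n → Fin k
      tcol-sym : ∀ u v → tcol u v ≡ tcol v u
  open TotalColouring public

  Rainbow : ∀ {k} → EdgeColouring k → ∀ {u v L} → Walk u v L → Set
  Rainbow c p = Unique (edgeColours (ecol c) p)

  TotalRainbow : ∀ {k} → TotalColouring k → ∀ {u v L} → Walk u v L → Set
  TotalRainbow c p = Unique (edgeColours (tcol c) p ++ map (vcol c) (innerVertices p))

  StrongRainbow : ∀ {k} → EdgeColouring k → Set
  StrongRainbow c = ∀ u v → ∃[ d ] Σ (Walk u v d) λ p → Dist u v d × Rainbow c p

  StrongTotalRainbow : ∀ {k} → TotalColouring k → Set
  StrongTotalRainbow c = ∀ u v → ∃[ d ] Σ (Walk u v d) λ p → Dist u v d × TotalRainbow c p

  IsSrc : ℕ → Set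
  IsSrc k = (Σ (EdgeColouring k) StrongRainbow)
          × (∀ m → Σ (EdgeColouring m) StrongRainbow → k ≤ m)

  IsStrc : ℕ → Set
  IsStrc k = (Σ (TotalColouring k) StrongTotalRainbow)
           × (∀ m → Σ (TotalColouring m) StrongTotalRainbow → k ≤ m)

module Submission where

-- Take an optimal strong rainbow edge-colouring c with s
-- colours and extend it to a total colouring with s+1 colours: every edge
-- keeps its colour, every vertex receives the one new colour.  A geodesic
-- in a graph of diameter 2 has length at most 2, hence at most one
-- internal vertex; so the total colour sequence of a rainbow geodesic is
-- its (distinct) edge colours followed by at most one occurrence of the
-- fresh colour, and it is total-rainbow.  The rainbow geodesics of c thus
-- witness that the extended colouring is strong total rainbow, and
-- minimality of strc gives strc(G) ≤ src(G) + 1.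

open import Defs
open import Data.Nat using (ℕ; suc; _≤_; s≤s)
open import Data.Nat.Properties using (≮⇒≥; ≤-trans)
open import Data.Fin using (Fin; inject₁; fromℕ)
open import Data.Fin.Properties using (fromℕ≢inject₁; inject₁-injective)
open import Data.List.Relation.Unary.All using ([]; _∷_)
open import Data.List.Relation.Unary.AllPairs using ([]; _∷_)
open import Data.Product using (_,_)
open import Relation.Binary.PropositionalEquality using (_≢_; sym; cong)

module _ {n : ℕ} (G : Graph n) where

  dist-≤-walk : ∀ {u v d m} → Dist G u v d → Walk G u v m → d ≤ m
  dist-≤-walk (_ , noShorter) walk = ≮⇒≥ (λ m<d → noShorter _ m<d walk)

  geodesic-≤-diameter : ∀ {D} → HasDiameter G D →
                        ∀ {u v d} → Dist G u v d → d ≤ D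
  geodesic-≤-diameter (bounded , _) {u} {v} dist with bounded u v
  ... | d′ , d′≤D , (walk′ , _) = ≤-trans (dist-≤-walk dist walk′) d′≤D

  module _ {s : ℕ} (c : EdgeColouring G s) where

    fresh : Fin (suc s)
    fresh = fromℕ s

    old≢fresh : ∀ (a : Fin s) → inject₁ a ≢ fresh
    old≢fresh a eq = fromℕ≢inject₁ (sym eq)

    extend : TotalColouring G (suc s)
    extend = record
      { vcol     = λ _ → fresh
      ; tcol     = λ u v → inject₁ (ecol c u v)
      ; tcol-sym = λ u v → cong inject₁ (ecol-sym c u v)
      }

    short-rainbow⇒total-rainbow : ∀ {u v d} (p : Walk G u v d) → d ≤ 2 →
                                  Rainbow G c p → TotalRainbow G extend p
    short-rainbow⇒total-rainbow [] _ _ = []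
    short-rainbow⇒total-rainbow (_ ∷ []) _ _ = [] ∷ []
    short-rainbow⇒total-rainbow (_ ∷ _ ∷ []) _ ((a≢b ∷ []) ∷ _) =
        ((λ eq → a≢b (inject₁-injective eq)) ∷ old≢fresh _ ∷ [])
      ∷ (old≢fresh _ ∷ [])
      ∷ []
      ∷ []
    short-rainbow⇒total-rainbow (_ ∷ _ ∷ _ ∷ _) (s≤s (s≤s ())) _

    extend-strong : HasDiameter G 2 → StrongRainbow G c →
                    StrongTotalRainbow G extend
    extend-strong diam strong u v with strong u v
    ... | d , p , dist , rainbow =
      d , p , dist ,
      short-rainbow⇒total-rainbow p (geodesic-≤-diameter diam dist) rainbow

proposition2p1 : ∀ {n} (G : Graph n) → HasDiameter G 2 →
    ∀ s t → IsSrc G s → IsStrc G t → t ≤ suc s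
proposition2p1 G diam s t ((c , strong) , _) (_ , strc-minimal) =
  strc-minimal (suc s) (extend G c , extend-strong G c diam strong)
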